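{- Let $\Gamma$ be a finite simple graph on $n$ vertices. Then $\Gamma$ is uniformly vertex-transitive if and only if $\omega(D(\Gamma)_{\mathrm{id}}) = n-1$, where $D(\Gamma)_{\mathrm{id}}$ is the neighborhood of the identity automorphism in the derangement graph $D(\Gamma)$.
   Context: Each automorphism $\sigma$ of a graph on $n$ vertices is identified with its $n\times n$ permutation matrix (whose $(u,v)$ entry is $1$ iff $\sigma(u)=v$). $J_n$ denotes the $n\times n$ all-ones matrix. A graph $\Gamma$ on $n$ vertices is uniformly vertex-transitive if there is a subset $\{\sigma_1,\ldots,\sigma_n\}\subset\mathrm{Aut}(\Gamma)$ of size $n$ with $\sum_i\sigma_i = J_n$ (such a subset is called a maximal Schur set). A derangement is a permutation without fixed points; $\mathrm{Der}_\Gamma$ is the set of derangements in $\mathrm{Aut}(\Gamma)$. The derangement graph $D(\Gamma)$ has vertex set $\mathrm{Aut}(\Gamma)$, with $\sigma,\tau$ adjacent iff $\sigma^{ -1}\tau\in\mathrm{Der}_\Gamma$. For a graph $X$ and vertex $v$, $X_v$ is the subgraph induced on the set of vertices adjacent to $v$, and $\omega(X)$ is the clique number (maximum size of a set of pairwise adjacent vertices). -}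

module Defs where

open import Level using (0ℓ)
open import Data.Nat using (ℕ; zero; suc; _+_; _≤_; _∸_)
open import Data.Fin using (Fin; zero; suc; _≟_)
open import Data.Fin.Permutation using (Permutation′; _⟨$⟩ʳ_; _⟨$⟩ˡ_)
open import Data.Product using (Σ; ∃; _×_; _,_; proj₁)
open import Data.Bool using (if_then_else_)
open import Relation.Nullary using (¬_)
open import Relation.Nullary.Decidable using (⌊_⌋)
open import Relation.Binary.PropositionalEquality using (_≡_; _≢_)
open import Function.Bundles using (_⇔_)

record Graph (n : ℕ) : Set₁ where
  field
    Adj    : Fin n → Fin n → Set
    sym    : ∀ {u v} → Adj u v → Adj v u
    irrefl : ∀ {u} → ¬ Adj u u
open Graph public

IsAut : ∀ {n} → Graph n → Permutation′ n → Set
IsAut Γ σ = ∀ u v → Adj Γ u v ⇔ Adj Γ (σ ⟨$⟩ʳ u) (σ ⟨$⟩ʳ v)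

Aut : ∀ {n} → Graph n → Set
Aut Γ = Σ (Permutation′ _) (IsAut Γ)

app : ∀ {n} {Γ : Graph n} → Aut Γ → Fin n → Fin n
app σ u = proj₁ σ ⟨$⟩ʳ u

_≈ᴬ_ : ∀ {n} {Γ : Graph n} → Aut Γ → Aut Γ → Set
_≈ᴬ_ {Γ = Γ} σ τ = ∀ u → app {Γ = Γ} σ u ≡ app {Γ = Γ} τ u

∑ : ∀ {k} → (Fin k → ℕ) → ℕ
∑ {zero}  f = 0
∑ {suc k} f = f zero + ∑ (λ i → f (suc i))

permMatrix : ∀ {n} → Permutation′ n → Fin n → Fin n → ℕ
permMatrix σ u v = if ⌊ (σ ⟨$⟩ʳ u) ≟ v ⌋ then 1 else 0

J : ∀ n → Fin n → Fin n → ℕ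
J n u v = 1

IsMaximalSchurSet : ∀ {n} (Γ : Graph n) → (Fin n → Aut Γ) → Set
IsMaximalSchurSet {n} Γ s =
  (∀ i j → i ≢ j → ¬ (_≈ᴬ_ {Γ = Γ} (s i) (s j))) ×
  (∀ u v → ∑ (λ i → permMatrix (proj₁ (s i)) u v) ≡ J n u v)

UniformlyVertexTransitive : ∀ {n} → Graph n → Set
UniformlyVertexTransitive {n} Γ = ∃ λ (s : Fin n → Aut Γ) → IsMaximalSchurSet Γ s

IsDerangement : ∀ {n} → (Fin n → Fin n) → Set
IsDerangement f = ∀ u → f u ≢ u

-- σ⁻¹τ as a permutation matrix product: u ↦ τ(σ⁻¹(u))
DerAdj : ∀ {n} {Γ : Graph n} → Aut Γ → Aut Γ → Set
DerAdj σ τ = IsDerangement (λ u → proj₁ τ ⟨$⟩ʳ (proj₁ σ ⟨$⟩ˡ u))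

record AbsGraph : Set₁ where
  field
    V   : Set
    _≈_ : V → V → Set
    _~_ : V → V → Set
open AbsGraph public

D : ∀ {n} → Graph n → AbsGraph
D Γ = record { V = Aut Γ ; _≈_ = _≈ᴬ_ {Γ = Γ} ; _~_ = DerAdj {Γ = Γ} }

Nbhd : (X : AbsGraph) → V X → AbsGraph
Nbhd X v = record
  { V   = Σ (V X) (λ w → _~_ X v w)
  ; _≈_ = λ a b → _≈_ X (proj₁ a) (proj₁ b)
  ; _~_ = λ a b → _~_ X (proj₁ a) (proj₁ b)
  }

IsClique : (X : AbsGraph) {k : ℕ} → (Fin k → V X) → Set
IsClique X {k} c = ∀ i j → i ≢ j → ¬ (_≈_ X (c i) (c j)) × _~_ X (c i) (c j)

HasClique : AbsGraph → ℕ → Set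
HasClique X k = ∃ λ (c : Fin k → V X) → IsClique X c

CliqueNumberIs : AbsGraph → ℕ → Set
CliqueNumberIs X m = HasClique X m × (∀ k → HasClique X k → k ≤ m)

idAut : ∀ {n} (Γ : Graph n) → Aut Γ
idAut Γ = Data.Fin.Permutation.id , λ u v → record
  { to = λ x → x ; from = λ x → x ; to-cong = λ e → e ; from-cong = λ e → e }
  where import Data.Fin.Permutation

module Submission where

open import Defs
open import Data.Nat using (ℕ; zero; suc; _+_; _≤_; _∸_; z≤n; s≤s)
open import Data.Nat.Properties
  using (≤-trans; ≤-reflexive; +-comm; m≤m+n; m≤n+m; +-monoʳ-≤; 1+n≰n; ≤-pred; module ≤-Reasoning)
open import Data.Fin using (Fin; zero; suc; _≟_; punchOut)
open import Data.Fin.Properties using (suc-injective; punchOut-injective; injective⇒≤; any?)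
open import Data.Fin.Permutation using (_⟨$⟩ʳ_; _⟨$⟩ˡ_; inverseˡ; inverseʳ; flip; _∘ₚ_)
open import Data.Vec.Functional using (_∷_)
open import Data.Product using (∃; _,_; proj₁; proj₂)
open import Data.Empty using (⊥-elim)
open import Relation.Nullary using (¬_; yes; no)
open import Relation.Binary.PropositionalEquality
  using (_≡_; _≢_; refl; trans; cong; subst₂)
  renaming (sym to ≡-sym)
open import Function.Base using (_∘_)
open import Function.Bundles using (_⇔_; mk⇔; Equivalence)
open import Function.Definitions using (Injective)
import Function.Properties.Equivalence as ⇔

-- Call a family of automorphisms σ₁,…,σₖ *separated* if any
-- two of them disagree at every vertex.  Three observations drive the proof:
--   * τ is a neighbour of σ in D(Γ) iff σ and τ disagree at every vertex,
--     so a clique of D(Γ)_id is a family which stays separated when id is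
--     added to it;
--   * n automorphisms have permutation matrices summing to J_n iff they are
--     separated (the (u,v) entry of the sum counts the σᵢ sending u to v;
--     for a separated family of size n the map i ↦ σᵢ(u) is a bijection);
--   * a separated family has at most n members (i ↦ σᵢ(u) is injective),
--     and right multiplication by σ₁⁻¹ keeps it separated while turning σ₁
--     into the identity.
-- Hence a maximal Schur set yields an (n-1)-clique around id, every clique
-- there has at most n-1 elements, and an (n-1)-clique plus id is a maximal
-- Schur set.

∑-single-≤ : ∀ {k} (g : Fin k → ℕ) (i : Fin k) → g i ≤ ∑ g
∑-single-≤ g zero    = m≤m+n _ _
∑-single-≤ g (suc i) = ≤-trans (∑-single-≤ (g ∘ suc) i) (m≤n+m _ (g zero))

∑-pair-≤ : ∀ {k} (g : Fin k → ℕ) (i j : Fin k) → i ≢ j → g i + g j ≤ ∑ g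
∑-pair-≤ g zero    zero    i≢j = ⊥-elim (i≢j refl)
∑-pair-≤ g zero    (suc j) i≢j = +-monoʳ-≤ (g zero) (∑-single-≤ (g ∘ suc) j)
∑-pair-≤ g (suc i) zero    i≢j =
  ≤-trans (≤-reflexive (+-comm (g (suc i)) (g zero)))
          (+-monoʳ-≤ (g zero) (∑-single-≤ (g ∘ suc) i))
∑-pair-≤ g (suc i) (suc j) i≢j =
  ≤-trans (∑-pair-≤ (g ∘ suc) i j (i≢j ∘ cong suc)) (m≤n+m _ (g zero))

∑-zero : ∀ {k} (g : Fin k → ℕ) → (∀ j → g j ≡ 0) → ∑ g ≡ 0
∑-zero {zero}  g g≡0 = refl
∑-zero {suc k} g g≡0 rewrite g≡0 zero = ∑-zero (g ∘ suc) (g≡0 ∘ suc)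

∑-indicator : ∀ {k} (g : Fin k → ℕ) (i : Fin k) →
              g i ≡ 1 → (∀ j → j ≢ i → g j ≡ 0) → ∑ g ≡ 1
∑-indicator g zero    gi≡1 rest rewrite gi≡1 =
  cong suc (∑-zero (g ∘ suc) (λ j → rest (suc j) (λ ())))
∑-indicator g (suc i) gi≡1 rest rewrite rest zero (λ ()) =
  ∑-indicator (g ∘ suc) i gi≡1 (λ j j≢i → rest (suc j) (j≢i ∘ suc-injective))

permMatrix-hit : ∀ {n} σ (u v : Fin n) → σ ⟨$⟩ʳ u ≡ v → permMatrix σ u v ≡ 1
permMatrix-hit σ u v σu≡v with (σ ⟨$⟩ʳ u) ≟ v
... | yes _    = refl
... | no σu≢v = ⊥-elim (σu≢v σu≡v)

permMatrix-miss : ∀ {n} σ (u v : Fin n) → σ ⟨$⟩ʳ u ≢ v → permMatrix σ u v ≡ 0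
permMatrix-miss σ u v σu≢v with (σ ⟨$⟩ʳ u) ≟ v
... | yes σu≡v = ⊥-elim (σu≢v σu≡v)
... | no _     = refl

-- An injective self-map of Fin n is surjective: a missed value v would let
-- punchOut compress the map injectively into Fin (n - 1).
injective⇒surjective : ∀ {n} (f : Fin n → Fin n) → Injective _≡_ _≡_ f →
                       ∀ v → ∃ λ i → f i ≡ v
injective⇒surjective {suc m} f f-inj v with any? (λ i → f i ≟ v)
... | yes hit = hit
... | no miss = ⊥-elim (1+n≰n (injective⇒≤ compressed-injective))
  where
  v≢f : ∀ i → v ≢ f i
  v≢f i v≡fi = miss (i , ≡-sym v≡fi)

  compressed-injective : Injective _≡_ _≡_ (λ i → punchOut (v≢f i))
  compressed-injective = f-inj ∘ punchOut-injective (v≢f _) (v≢f _)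

module Automorphisms {n : ℕ} (Γ : Graph n) where

  infixl 5 _·_
  infixr 6 _⨾_
  infix 7 _⁻¹ᴬ
  _·_ : Aut Γ → Fin n → Fin n
  σ · x = app {Γ = Γ} σ x

  -- Automorphisms are closed under inverse and composition;
  -- (σ ⨾ τ) · x = τ · (σ · x).
  _⁻¹ᴬ : Aut Γ → Aut Γ
  (σ , σ-aut) ⁻¹ᴬ = flip σ , λ u v →
    ⇔.sym (subst₂ (λ a b → Adj Γ (σ ⟨$⟩ˡ u) (σ ⟨$⟩ˡ v) ⇔ Adj Γ a b)
                  (inverseʳ σ) (inverseʳ σ) (σ-aut (σ ⟨$⟩ˡ u) (σ ⟨$⟩ˡ v)))

  _⨾_ : Aut Γ → Aut Γ → Aut Γ
  (σ , σ-aut) ⨾ (τ , τ-aut) = σ ∘ₚ τ , λ u v → ⇔.trans (σ-aut u v) (τ-aut _ _)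

  ⁻¹ᴬ-cancel : ∀ σ x → σ · (σ ⁻¹ᴬ · x) ≡ x
  ⁻¹ᴬ-cancel σ x = inverseʳ (proj₁ σ)

  Disagree : Aut Γ → Aut Γ → Set
  Disagree σ τ = ∀ x → σ · x ≢ τ · x

  -- Adjacency in the derangement graph is everywhere-disagreement:
  -- τσ⁻¹ fixes u exactly when σ and τ agree at σ⁻¹(u).
  derAdj⇔disagree : ∀ σ τ → DerAdj {Γ = Γ} σ τ ⇔ Disagree σ τ
  derAdj⇔disagree σ τ = mk⇔ to from
    where
    to : DerAdj {Γ = Γ} σ τ → Disagree σ τ
    to der x σx≡τx = der (σ · x) (trans (cong (τ ·_) (inverseˡ (proj₁ σ))) (≡-sym σx≡τx))

    from : Disagree σ τ → DerAdj {Γ = Γ} σ τ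
    from dis u τσ⁻¹u≡u = dis (σ ⁻¹ᴬ · u) (trans (⁻¹ᴬ-cancel σ u) (≡-sym τσ⁻¹u≡u))

  record Separated {k} (s : Fin k → Aut Γ) : Set where
    constructor separated
    field apart : ∀ i j → i ≢ j → Disagree (s i) (s j)
  open Separated

  separated⇒injective : ∀ {k} {s : Fin k → Aut Γ} → Separated s →
                        ∀ x → Injective _≡_ _≡_ (λ i → s i · x)
  separated⇒injective sep x {i} {j} six≡sjx with i ≟ j
  ... | yes i≡j = i≡j
  ... | no i≢j  = ⊥-elim (apart sep i j i≢j x six≡sjx)

  separated⇒≤ : ∀ {k} {s : Fin k → Aut Γ} → Fin n → Separated s → k ≤ n
  separated⇒≤ x sep = injective⇒≤ (separated⇒injective sep x)

  separated⇒distinct : ∀ {k} {s : Fin k → Aut Γ} → Fin n → Separated s →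
                       ∀ i j → i ≢ j → ¬ (_≈ᴬ_ {Γ = Γ} (s i) (s j))
  separated⇒distinct x sep i j i≢j s≈s = apart sep i j i≢j x (s≈s x)

  SumsToJ : ∀ {k} → (Fin k → Aut Γ) → Set
  SumsToJ s = ∀ u v → ∑ (λ i → permMatrix (proj₁ (s i)) u v) ≡ J n u v

  -- If the matrices sum to J_n, no two members agree anywhere: two members
  -- agreeing at x would contribute 2 to an entry of J_n.
  sumsToJ⇒separated : ∀ {k} (s : Fin k → Aut Γ) → SumsToJ s → Separated s
  sumsToJ⇒separated s sums =
    separated λ i j i≢j x six≡sjx → 1+n≰n (two≤one i j i≢j x six≡sjx)
    where
    two≤one : ∀ i j → i ≢ j → ∀ x → s i · x ≡ s j · x → 2 ≤ 1
    two≤one i j i≢j x six≡sjx = begin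
      2                 ≡⟨ two≡1+1 (permMatrix-hit (proj₁ (s i)) x _ refl)
                                   (permMatrix-hit (proj₁ (s j)) x _ (≡-sym six≡sjx)) ⟩
      entry i + entry j ≤⟨ ∑-pair-≤ entry i j i≢j ⟩
      ∑ entry           ≡⟨ sums x (s i · x) ⟩
      1                 ∎
      where
      entry : Fin _ → ℕ
      entry l = permMatrix (proj₁ (s l)) x (s i · x)

      open ≤-Reasoning
      two≡1+1 : ∀ {a b} → a ≡ 1 → b ≡ 1 → 2 ≡ a + b
      two≡1+1 refl refl = refl

  -- Conversely the matrices of a separated family of exactly n members sum
  -- to J_n: i ↦ sᵢ(u) is a bijection, so exactly one member sends u to v.
  separated⇒sumsToJ : {s : Fin n → Aut Γ} → Separated s → SumsToJ s
  separated⇒sumsToJ {s} sep u v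
    with i , siu≡v ← injective⇒surjective _ (separated⇒injective sep u) v =
    ∑-indicator _ i (permMatrix-hit (proj₁ (s i)) u v siu≡v)
      (λ j j≢i → permMatrix-miss (proj₁ (s j)) u v
                   (λ sju≡v → apart sep j i j≢i u (trans sju≡v (≡-sym siu≡v))))

  -- Right translation ρ ⨾ – preserves separation (compare at ρ(x)).
  separated-translate : ∀ {k} {s : Fin k → Aut Γ} → Separated s →
                        ∀ ρ → Separated (λ i → ρ ⨾ s i)
  separated-translate sep ρ = separated λ i j i≢j x → apart sep i j i≢j (ρ · x)

  D-id : AbsGraph
  D-id = Nbhd (D Γ) (idAut Γ)

  clique⇒separated : ∀ {k} (c : Fin k → V D-id) → IsClique D-id c →
                     Separated (idAut Γ ∷ (proj₁ ∘ c))
  clique⇒separated c clique = separated apart-id∷c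
    where
    id-disagree : ∀ i → Disagree (idAut Γ) (proj₁ (c i))
    id-disagree i = Equivalence.to (derAdj⇔disagree (idAut Γ) (proj₁ (c i))) (proj₂ (c i))

    apart-id∷c : ∀ i j → i ≢ j →
                 Disagree ((idAut Γ ∷ (proj₁ ∘ c)) i) ((idAut Γ ∷ (proj₁ ∘ c)) j)
    apart-id∷c zero    zero    i≢j      = ⊥-elim (i≢j refl)
    apart-id∷c zero    (suc j) _        = id-disagree j
    apart-id∷c (suc i) zero    _    x e = id-disagree i x (≡-sym e)
    apart-id∷c (suc i) (suc j) si≢sj    =
      Equivalence.to (derAdj⇔disagree (proj₁ (c i)) (proj₁ (c j)))
                     (proj₂ (clique i j (si≢sj ∘ cong suc)))

  -- A separated family of k+1 members gives a k-clique around id: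
  -- translate by s₀⁻¹, which turns s₀ into the identity.
  separated⇒clique : ∀ {k} {s : Fin (suc k) → Aut Γ} → Fin n → Separated s → HasClique D-id k
  separated⇒clique {k} {s} x sep = c , clique
    where
    t : Fin (suc k) → Aut Γ
    t i = s zero ⁻¹ᴬ ⨾ s i

    t-sep : Separated t
    t-sep = separated-translate sep (s zero ⁻¹ᴬ)

    c : Fin k → V D-id
    c i = t (suc i) , Equivalence.from (derAdj⇔disagree (idAut Γ) (t (suc i))) id-disagree
      where
      id-disagree : Disagree (idAut Γ) (t (suc i))
      id-disagree y y≡ti = apart t-sep zero (suc i) (λ ()) y
        (trans (⁻¹ᴬ-cancel (s zero) y) y≡ti)

    clique : IsClique D-id c
    clique i j i≢j = separated⇒distinct x t-sep (suc i) (suc j) (i≢j ∘ suc-injective)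
                   , Equivalence.from (derAdj⇔disagree (t (suc i)) (t (suc j)))
                       (apart t-sep (suc i) (suc j) (i≢j ∘ suc-injective))

theorem3p6 : ∀ {n : ℕ} → 1 ≤ n → (Γ : Graph n) →
    UniformlyVertexTransitive Γ ⇔ CliqueNumberIs (Nbhd (D Γ) (idAut Γ)) (n ∸ 1)
theorem3p6 {suc m} (s≤s z≤n) Γ = mk⇔ schur⇒clique clique⇒schur
  where
  open Automorphisms Γ

  bound : ∀ k → HasClique D-id k → k ≤ m
  bound k (c , clique) = ≤-pred (separated⇒≤ zero (clique⇒separated c clique))

  schur⇒clique : UniformlyVertexTransitive Γ → CliqueNumberIs D-id m
  schur⇒clique (s , _ , sums) = separated⇒clique zero (sumsToJ⇒separated s sums) , bound

  clique⇒schur : CliqueNumberIs D-id m → UniformlyVertexTransitive Γ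
  clique⇒schur ((c , clique) , _) =
    idAut Γ ∷ (proj₁ ∘ c) , separated⇒distinct zero sep , separated⇒sumsToJ sep
    where
    sep : Separated (idAut Γ ∷ (proj₁ ∘ c))
    sep = clique⇒separated c clique
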